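{- Let $n$ be a positive integer divisible by $4$, and put $m=n/2$ and $p=n^2/2$. For $1\le i\le n$ and $1\le c\le m$ let $x_{i,c}=(c-1)n+i$. Call a row index $i$ \emph{switched} if either ($i\le m$ and $i$ is even) or ($i>m$ and $i$ is odd). Define an $n\times n$ array $B=(b_{i,j})$ by $$b_{i,c}=\begin{cases}x_{i,c} & \text{if } i \text{ is not switched},\\ n^2+1-x_{i,c} & \text{if } i \text{ is switched},\end{cases}\qquad b_{i,n+1-c}=n^2+1-b_{i,c}\qquad (1\le i\le n,\ 1\le c\le m).$$ Let $A=(a_{i,j})$ be the array obtained from $B$ by interchanging the entries in positions $(m+1,m)$ and $(n,m)$, and interchanging the entries in positions $(m+1,m+1)$ and $(n,m+1)$ (all other entries unchanged). Then $A$ is a parallel magic square of order $n$: its entries are exactly $1,2,\dots,n^2$, every row, every column and both main diagonals have sum $n(n^2+1)/2$, and all its complementary pairs are placed parallel to one another (indeed $a_{i,j}+a_{i,n+1-j}=n^2+1$ for all $i,j$).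
   Context: A (primitive) magic square of order $n$ is an $n\times n$ array containing each of the numbers $1,2,\dots,n^2$ exactly once such that every row, every column and both main diagonals sum to $n(n^2+1)/2$. Two entries form a complementary pair if they sum to $n^2+1$. A magic square is called parallel if all its complementary pairs are placed parallel to one another, i.e. the line segments joining the two cells of each complementary pair are all parallel. -}

module Defs where

open import Data.Nat using (ℕ; zero; suc; _+_; _*_; _∸_; _≤_; _<_; _≤ᵇ_; _≡ᵇ_)
open import Data.Nat.DivMod using (_/_; _%_)
open import Data.Bool using (Bool; true; false; if_then_else_; _∧_; _∨_; not)
open import Data.Fin using (Fin; toℕ; opposite)
open import Data.Product using (_×_; ∃; ∃-syntax; _,_)
open import Data.Integer as ℤ using (ℤ; +_)
open import Relation.Binary.PropositionalEquality using (_≡_)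

sumFin : ∀ {k} → (Fin k → ℕ) → ℕ
sumFin {zero}  f = 0
sumFin {suc k} f = f Fin.zero + sumFin (λ i → f (Fin.suc i))

ContainsEachOnce : (n : ℕ) → (Fin n → Fin n → ℕ) → Set
ContainsEachOnce n M =
  (∀ i j → 1 ≤ M i j × M i j ≤ n * n) ×
  (∀ v → 1 ≤ v → v ≤ n * n →
     ∃[ i ] ∃[ j ] (M i j ≡ v × (∀ i' j' → M i' j' ≡ v → i' ≡ i × j' ≡ j)))

magicConst : ℕ → ℕ
magicConst n = n * (n * n + 1) / 2

IsMagicSquare : (n : ℕ) → (Fin n → Fin n → ℕ) → Set
IsMagicSquare n M =
  ContainsEachOnce n M ×
  (∀ i → sumFin (λ j → M i j) ≡ magicConst n) ×
  (∀ j → sumFin (λ i → M i j) ≡ magicConst n) ×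
  (sumFin (λ i → M i i) ≡ magicConst n) ×
  (sumFin (λ i → M i (opposite i)) ≡ magicConst n)

Complementary : (n : ℕ) → (Fin n → Fin n → ℕ) → Fin n → Fin n → Fin n → Fin n → Set
Complementary n M i j i' j' = M i j + M i' j' ≡ n * n + 1

δ : ∀ {n} → Fin n → Fin n → ℤ
δ a b = + toℕ b ℤ.- + toℕ a

-- all segments joining complementary pairs are parallel
-- (displacement vectors (di,dj), (dk,dl) parallel iff di*dl = dj*dk)
AllComplementaryPairsParallel : (n : ℕ) → (Fin n → Fin n → ℕ) → Set
AllComplementaryPairsParallel n M =
  ∀ i j i' j' k l k' l' →
  Complementary n M i j i' j' → Complementary n M k l k' l' →
  δ i i' ℤ.* δ l l' ≡ δ j j' ℤ.* δ k k'

IsParallelMagicSquare : (n : ℕ) → (Fin n → Fin n → ℕ) → Set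
IsParallelMagicSquare n M = IsMagicSquare n M × AllComplementaryPairsParallel n M

-- The construction (1-based natural-number indices, as in the paper)

module Construction (n : ℕ) where
  m : ℕ
  m = n / 2

  x : ℕ → ℕ → ℕ
  x i c = (c ∸ 1) * n + i

  isEven : ℕ → Bool
  isEven i = i % 2 ≡ᵇ 0

  switched : ℕ → Bool
  switched i = ((i ≤ᵇ m) ∧ isEven i) ∨ (not (i ≤ᵇ m) ∧ not (isEven i))

  bLeft : ℕ → ℕ → ℕ
  bLeft i c = if switched i then n * n + 1 ∸ x i c else x i c

  b : ℕ → ℕ → ℕ
  b i j = if j ≤ᵇ m then bLeft i j else n * n + 1 ∸ bLeft i (n + 1 ∸ j)

  a : ℕ → ℕ → ℕ
  a i j =
    if (j ≡ᵇ m) ∨ (j ≡ᵇ m + 1)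
    then (if i ≡ᵇ m + 1 then b n j else if i ≡ᵇ n then b (m + 1) j else b i j)
    else b i j

  A : Fin n → Fin n → ℕ
  A i j = a (suc (toℕ i)) (suc (toℕ j))

-- Index rows and columns from 0 and write ȳ = n − 1 − y.  Every entry of B is 1 + Q n + R
-- for base-n digits Q, R: the high digit Q is the column c, or c̄ in a switched row, and
-- the low digit R is the row r, or r̄ when Q lies in the right half.  The map (r, c) ↦ (Q, R)
-- is a bijection onto pairs of digits, so B contains 1, …, n² once each; replacing c by c̄
-- mirrors both digits, so b(r, c) + b(r, c̄) = n² + 1.  A interchanges rows m and n − 1
-- within the two middle columns, which c ↦ c̄ exchanges, so A inherits both facts, and
-- complementary entries of A share a row: all complementary pairs are horizontal.  Rows and
-- the anti-diagonal have the magic sum because they pair up into complements; a left column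
-- splits into adjacent rows (2t, 2t+1), worth n² each in the top half and n² + 2 in the
-- bottom half, and a right column is the complement of a left one; the main diagonal pairs
-- up the same way, and the interchange adds exactly m at the cell (m, m).

module Submission where

open import Defs
open import Data.Bool using (Bool; true; false; if_then_else_; not; _∧_; _∨_)
open import Data.Bool.Properties using (if-float; ∨-comm)
open import Data.Fin as Fin using (Fin; toℕ; fromℕ<; opposite)
open import Data.Fin.Properties using (opposite-prop; toℕ<n; toℕ-injective; toℕ-fromℕ<)
import Data.Integer as ℤ
import Data.Integer.Properties as ℤ
open import Data.Nat
open import Data.Nat.DivMod
open import Data.Nat.Divisibility using (_∣_; divides)
open import Data.Nat.Properties
open import Algebra.Properties.CommutativeSemigroup +-commutativeSemigroup
  using (interchange; xy∙z≈xz∙y; xy∙z≈zy∙x)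
open import Data.Nat.Tactic.RingSolver using (solve-∀)
open import Data.Product using (∃-syntax; _×_; _,_; proj₁; proj₂; map)
open import Function using (_∘_; _⇔_; mk⇔; Equivalence)
open import Relation.Nullary using (yes; no)
open import Relation.Nullary.Decidable using (dec-true; dec-false)
open import Relation.Binary.PropositionalEquality
open ≡-Reasoning

if-preserves : ∀ (P : ℕ → Set) β {x y} → P x → P y → P (if β then x else y)
if-preserves P true  px py = px
if-preserves P false px py = py

-- does (x ≟ y) and does (x ≤? y) compute to x ≡ᵇ y and x ≤ᵇ y.
≡ᵇ-true : ∀ {x y} → x ≡ y → (x ≡ᵇ y) ≡ true
≡ᵇ-true {x} {y} = dec-true (x ≟ y)

≡ᵇ-false : ∀ {x y} → x ≢ y → (x ≡ᵇ y) ≡ false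
≡ᵇ-false {x} {y} = dec-false (x ≟ y)

≤ᵇ-true : ∀ {x y} → x ≤ y → (x ≤ᵇ y) ≡ true
≤ᵇ-true {x} {y} = dec-true (x ≤? y)

≤ᵇ-false : ∀ {x y} → y < x → (x ≤ᵇ y) ≡ false
≤ᵇ-false {x} {y} y<x = dec-false (x ≤? y) (<⇒≱ y<x)

≡ᵇ-cong-⇔ : ∀ {x y u v} → (x ≡ y ⇔ u ≡ v) → (x ≡ᵇ y) ≡ (u ≡ᵇ v)
≡ᵇ-cong-⇔ {x} {y} x≡y⇔u≡v with x ≟ y
... | yes x≡y = trans (≡ᵇ-true x≡y) (sym (≡ᵇ-true (Equivalence.to x≡y⇔u≡v x≡y)))
... | no  x≢y = trans (≡ᵇ-false x≢y) (sym (≡ᵇ-false (x≢y ∘ Equivalence.from x≡y⇔u≡v)))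

∑ : ℕ → (ℕ → ℕ) → ℕ
∑ zero    f = 0
∑ (suc n) f = f 0 + ∑ n (f ∘ suc)

sumFin≡∑ : ∀ n {f : Fin n → ℕ} (g : ℕ → ℕ) → (∀ i → f i ≡ g (toℕ i)) → sumFin f ≡ ∑ n g
sumFin≡∑ zero    g f≗g = refl
sumFin≡∑ (suc n) g f≗g = cong₂ _+_ (f≗g Fin.zero) (sumFin≡∑ n (g ∘ suc) (f≗g ∘ Fin.suc))

∑-cong : ∀ n {f g : ℕ → ℕ} → (∀ r → r < n → f r ≡ g r) → ∑ n f ≡ ∑ n g
∑-cong zero    f≗g = refl
∑-cong (suc n) f≗g = cong₂ _+_ (f≗g 0 z<s) (∑-cong n (λ r r<n → f≗g (suc r) (s<s r<n)))

∑-const : ∀ n c → ∑ n (λ _ → c) ≡ n * c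
∑-const zero    c = refl
∑-const (suc n) c = cong (c +_) (∑-const n c)

∑-distrib-+ : ∀ n (f g : ℕ → ℕ) → ∑ n (λ r → f r + g r) ≡ ∑ n f + ∑ n g
∑-distrib-+ zero    f g = refl
∑-distrib-+ (suc n) f g =
  trans (cong (f 0 + g 0 +_) (∑-distrib-+ n (f ∘ suc) (g ∘ suc))) (interchange (f 0) (g 0) _ _)

∑-split : ∀ a b f → ∑ (a + b) f ≡ ∑ a f + ∑ b (λ r → f (a + r))
∑-split zero    b f = refl
∑-split (suc a) b f = trans (cong (f 0 +_) (∑-split a b (f ∘ suc))) (sym (+-assoc (f 0) _ _))

∑-pairs : ∀ s f → ∑ (s * 2) f ≡ ∑ s (λ t → f (t * 2) + f (suc (t * 2)))
∑-pairs zero    f = refl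
∑-pairs (suc s) f =
  trans (cong (λ x → f 0 + (f 1 + x)) (∑-pairs s (f ∘ suc ∘ suc))) (sym (+-assoc (f 0) (f 1) _))

∑-snoc : ∀ n f → ∑ (suc n) f ≡ ∑ n f + f n
∑-snoc zero    f = +-comm (f 0) 0
∑-snoc (suc n) f = trans (cong (f 0 +_) (∑-snoc n (f ∘ suc))) (sym (+-assoc (f 0) _ _))

∑-reverse : ∀ n f → ∑ n f ≡ ∑ n (λ r → f (n ∸ suc r))
∑-reverse zero    f = refl
∑-reverse (suc n) f = begin
  ∑ (suc n) f                     ≡⟨ ∑-snoc n f ⟩
  ∑ n f + f n                     ≡⟨ cong (_+ f n) (∑-reverse n f) ⟩
  ∑ n (λ r → f (n ∸ suc r)) + f n ≡⟨ +-comm _ (f n) ⟩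
  f n + ∑ n (λ r → f (n ∸ suc r)) ∎

∑-differ-at : ∀ n {f g : ℕ → ℕ} {p} → p < n → (∀ r → r < n → r ≢ p → f r ≡ g r) →
              ∑ n f + g p ≡ ∑ n g + f p
∑-differ-at (suc n) {f} {g} {zero} _ f≗g = begin
  f 0 + ∑ n (f ∘ suc) + g 0 ≡⟨ cong (λ s → f 0 + s + g 0) (∑-cong n (λ r r<n → f≗g (suc r) (s<s r<n) λ ())) ⟩
  f 0 + ∑ n (g ∘ suc) + g 0 ≡⟨ xy∙z≈zy∙x (f 0) _ (g 0) ⟩
  g 0 + ∑ n (g ∘ suc) + f 0 ∎
∑-differ-at (suc n) {f} {g} {suc p} (s<s p<n) f≗g = begin
  f 0 + ∑ n (f ∘ suc) + g (suc p)   ≡⟨ +-assoc (f 0) _ _ ⟩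
  f 0 + (∑ n (f ∘ suc) + g (suc p)) ≡⟨ cong₂ _+_ (f≗g 0 z<s λ ()) (∑-differ-at n p<n rest) ⟩
  g 0 + (∑ n (g ∘ suc) + f (suc p)) ≡⟨ +-assoc (g 0) _ _ ⟨
  g 0 + ∑ n (g ∘ suc) + f (suc p)   ∎
  where
  rest : ∀ r → r < n → r ≢ p → f (suc r) ≡ g (suc r)
  rest r r<n r≢p = f≗g (suc r) (s<s r<n) (r≢p ∘ suc-injective)

-- Pass through the function that agrees with g except at q, where it takes the value f q.
∑-differ-at₂ : ∀ n {f g : ℕ → ℕ} {p q} → p < n → q < n → p ≢ q →
               (∀ r → r < n → r ≢ p → r ≢ q → f r ≡ g r) → f p + f q ≡ g p + g q →
               ∑ n f ≡ ∑ n g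
∑-differ-at₂ n {f} {g} {p} {q} p<n q<n p≢q f≗g fp+fq = +-cancelʳ-≡ (g p + g q) _ _ (begin
  ∑ n f + (g p + g q)     ≡⟨ +-assoc (∑ n f) (g p) (g q) ⟨
  ∑ n f + g p + g q       ≡⟨ cong (λ x → ∑ n f + x + g q) (sym (h-off-q p≢q)) ⟩
  ∑ n f + h p + g q       ≡⟨ cong (_+ g q) (∑-differ-at n p<n f≗h) ⟩
  ∑ n h + f p + g q       ≡⟨ xy∙z≈xz∙y (∑ n h) (f p) (g q) ⟩
  ∑ n h + g q + f p       ≡⟨ cong (_+ f p) (∑-differ-at n q<n h≗g) ⟩
  ∑ n g + h q + f p       ≡⟨ cong (λ x → ∑ n g + x + f p) h-at-q ⟩
  ∑ n g + f q + f p       ≡⟨ xy∙z≈xz∙y (∑ n g) (f q) (f p) ⟩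
  ∑ n g + f p + f q       ≡⟨ +-assoc (∑ n g) (f p) (f q) ⟩
  ∑ n g + (f p + f q)     ≡⟨ cong (∑ n g +_) fp+fq ⟩
  ∑ n g + (g p + g q)     ∎)
  where
  h : ℕ → ℕ
  h r = if r ≡ᵇ q then f q else g r
  h-at-q : h q ≡ f q
  h-at-q = cong (if_then f q else g q) (≡ᵇ-true {q} refl)
  h-off-q : ∀ {r} → r ≢ q → h r ≡ g r
  h-off-q {r} r≢q = cong (if_then f q else g r) (≡ᵇ-false r≢q)
  f≗h : ∀ r → r < n → r ≢ p → f r ≡ h r
  f≗h r r<n r≢p with r ≟ q
  ... | yes refl = sym h-at-q
  ... | no r≢q   = trans (f≗g r r<n r≢p r≢q) (sym (h-off-q r≢q))
  h≗g : ∀ r → r < n → r ≢ q → h r ≡ g r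
  h≗g r _ = h-off-q

swap : ℕ → ℕ → ℕ → ℕ
swap p q r = if r ≡ᵇ p then q else if r ≡ᵇ q then p else r

module _ {p q : ℕ} where

  swap-at-p : swap p q p ≡ q
  swap-at-p = cong (if_then q else (if p ≡ᵇ q then p else p)) (≡ᵇ-true {p} refl)

  swap-at-q : p ≢ q → swap p q q ≡ p
  swap-at-q p≢q = trans (cong (if_then q else (if q ≡ᵇ q then p else q)) (≡ᵇ-false (p≢q ∘ sym)))
                        (cong (if_then p else q) (≡ᵇ-true {q} refl))

  swap-fixes : ∀ {r} → r ≢ p → r ≢ q → swap p q r ≡ r
  swap-fixes {r} r≢p r≢q = trans (cong (if_then q else (if r ≡ᵇ q then p else r)) (≡ᵇ-false r≢p))
                                 (cong (if_then p else r) (≡ᵇ-false r≢q))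

  swap-involutive : p ≢ q → ∀ r → swap p q (swap p q r) ≡ r
  swap-involutive p≢q r with r ≟ p | r ≟ q
  ... | yes refl | _        = trans (cong (swap p q) swap-at-p) (swap-at-q p≢q)
  ... | no _     | yes refl = trans (cong (swap p q) (swap-at-q p≢q)) swap-at-p
  ... | no r≢p   | no r≢q   = trans (cong (swap p q) (swap-fixes r≢p r≢q)) (swap-fixes r≢p r≢q)

  swap-< : ∀ {n r} → p < n → q < n → r < n → swap p q r < n
  swap-< {n} {r} p<n q<n r<n =
    if-preserves (_< n) (r ≡ᵇ p) q<n (if-preserves (_< n) (r ≡ᵇ q) p<n r<n)

  ∑-swap : ∀ n g → p < n → q < n → p ≢ q → ∑ n (g ∘ swap p q) ≡ ∑ n g
  ∑-swap n g p<n q<n p≢q = ∑-differ-at₂ n p<n q<n p≢q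
    (λ r _ r≢p r≢q → cong g (swap-fixes r≢p r≢q))
    (trans (cong₂ (λ x y → g x + g y) swap-at-p (swap-at-q p≢q)) (+-comm (g q) (g p)))

swapIf : Bool → ℕ → ℕ → ℕ → ℕ
swapIf β p q r = if β then swap p q r else r

swapIf-fixes : ∀ {p q r} → r ≢ p → r ≢ q → ∀ β → swapIf β p q r ≡ r
swapIf-fixes r≢p r≢q true  = swap-fixes r≢p r≢q
swapIf-fixes r≢p r≢q false = refl

module _ {p q : ℕ} (p≢q : p ≢ q) where

  swapIf-involutive : ∀ β r → swapIf β p q (swapIf β p q r) ≡ r
  swapIf-involutive true  = swap-involutive p≢q
  swapIf-involutive false r = refl

  swapIf-< : ∀ {n} β {r} → p < n → q < n → r < n → swapIf β p q r < n
  swapIf-< true  = swap-<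
  swapIf-< false _ _ r<n = r<n

  ∑-swapIf : ∀ n g β → p < n → q < n → ∑ n (λ r → g (swapIf β p q r)) ≡ ∑ n g
  ∑-swapIf n g true  p<n q<n = ∑-swap n g p<n q<n p≢q
  ∑-swapIf n g false _   _   = refl

module Digits (n : ℕ) where

  mirror : ℕ → ℕ
  mirror y = n ∸ suc y

  mirror-+ : ∀ {y} → y < n → mirror y + suc y ≡ n
  mirror-+ = m∸n+n≡m

  mirror-< : ∀ {y} → y < n → mirror y < n
  mirror-< = ∸-monoʳ-< z<s

  mirror-involutive : ∀ {y} → y < n → mirror (mirror y) ≡ y
  mirror-involutive {y} y<n = +-cancelʳ-≡ (suc (mirror y)) _ _ (begin
    mirror (mirror y) + suc (mirror y) ≡⟨ mirror-+ (mirror-< y<n) ⟩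
    n                                  ≡⟨ mirror-+ y<n ⟨
    mirror y + suc y                   ≡⟨ +-suc (mirror y) y ⟩
    suc (mirror y) + y                 ≡⟨ +-comm (suc (mirror y)) y ⟩
    y + suc (mirror y)                 ∎)

  suc-mirror : ∀ {y} → y < n → suc (mirror y) ≡ n + 1 ∸ suc y
  suc-mirror {y} y<n = sym (trans (cong (_∸ suc y) (+-comm n 1)) (+-∸-assoc 1 y<n))

  mirrorIf : Bool → ℕ → ℕ
  mirrorIf β y = if β then mirror y else y

  mirrorIf-< : ∀ β {y} → y < n → mirrorIf β y < n
  mirrorIf-< β y<n = if-preserves (_< n) β (mirror-< y<n) y<n

  mirrorIf-involutive : ∀ β {y} → y < n → mirrorIf β (mirrorIf β y) ≡ y
  mirrorIf-involutive true  = mirror-involutive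
  mirrorIf-involutive false _ = refl

  mirrorIf-mirror : ∀ β y → mirrorIf β (mirror y) ≡ mirror (mirrorIf β y)
  mirrorIf-mirror true  y = refl
  mirrorIf-mirror false y = refl

  mirrorIf-not : ∀ β {y} → y < n → mirrorIf (not β) y ≡ mirror (mirrorIf β y)
  mirrorIf-not true  y<n = sym (mirror-involutive y<n)
  mirrorIf-not false y<n = refl

  digit : ℕ → ℕ → ℕ
  digit Q R = suc (Q * n + R)

  digit-sucʳ : ∀ Q R → digit Q (suc R) ≡ suc (digit Q R)
  digit-sucʳ Q R = cong suc (+-suc (Q * n) R)

  digit-sucˡ : ∀ Q R → digit (suc Q) R ≡ digit Q R + n
  digit-sucˡ Q R = cong suc (shift Q R n)
    where
    shift : ∀ Q R n → suc Q * n + R ≡ Q * n + R + n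
    shift = solve-∀

  digit-≤ : ∀ {Q R} → Q < n → R < n → digit Q R ≤ n * n
  digit-≤ {Q} {R} Q<n R<n =
    ≤-trans (+-monoʳ-< (Q * n) R<n) (subst (_≤ n * n) (+-comm n (Q * n)) (*-monoˡ-≤ n Q<n))

  digit-mirror : ∀ {Q R} → Q < n → R < n → digit Q R + digit (mirror Q) (mirror R) ≡ n * n + 1
  digit-mirror {Q} {R} Q<n R<n = +-cancelʳ-≡ n _ _ (begin
    digit Q R + digit (mirror Q) (mirror R) + n     ≡⟨ expand Q R (mirror Q) (mirror R) n ⟩
    (mirror Q + suc Q) * n + (mirror R + suc R) + 1 ≡⟨ cong₂ (λ x y → x * n + y + 1) (mirror-+ Q<n) (mirror-+ R<n) ⟩
    n * n + n + 1                                   ≡⟨ xy∙z≈xz∙y (n * n) n 1 ⟩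
    n * n + 1 + n                                   ∎)
    where
    expand : ∀ Q R Q' R' n → suc (Q * n + R) + suc (Q' * n + R') + n ≡ (Q' + suc Q) * n + (R' + suc R) + 1
    expand = solve-∀

  digit-mirror-suc : ∀ {Q R} → Q < n → suc R < n → digit Q R + digit (mirror Q) (mirror (suc R)) ≡ n * n
  digit-mirror-suc {Q} {R} Q<n sR<n = suc-injective (begin
    suc (digit Q R) + digit (mirror Q) (mirror (suc R)) ≡⟨ cong (_+ digit (mirror Q) (mirror (suc R))) (digit-sucʳ Q R) ⟨
    digit Q (suc R) + digit (mirror Q) (mirror (suc R)) ≡⟨ digit-mirror Q<n sR<n ⟩
    n * n + 1                                           ≡⟨ +-comm (n * n) 1 ⟩
    suc (n * n)                                         ∎)

  complement-digit : ∀ {Q R} → Q < n → R < n → n * n + 1 ∸ digit (mirror Q) (mirror R) ≡ digit Q R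
  complement-digit {Q} {R} Q<n R<n =
    trans (cong (_∸ digit (mirror Q) (mirror R)) (sym (digit-mirror Q<n R<n)))
          (m+n∸n≡m (digit Q R) (digit (mirror Q) (mirror R)))

  mirrorIf-complement : ∀ β {Q R} → Q < n → R < n →
    (if β then n * n + 1 ∸ digit Q R else digit Q R) ≡ digit (mirrorIf β Q) (mirrorIf β R)
  mirrorIf-complement true  {Q} {R} Q<n R<n = begin
    n * n + 1 ∸ digit Q R
      ≡⟨ cong₂ (λ x y → n * n + 1 ∸ digit x y) (mirror-involutive Q<n) (mirror-involutive R<n) ⟨
    n * n + 1 ∸ digit (mirror (mirror Q)) (mirror (mirror R))
      ≡⟨ complement-digit (mirror-< Q<n) (mirror-< R<n) ⟩
    digit (mirror Q) (mirror R)
      ∎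
  mirrorIf-complement false Q<n R<n = refl

  digit-injective : ∀ {Q R Q' R'} → R < n → R' < n → digit Q R ≡ digit Q' R' → Q ≡ Q' × R ≡ R'
  digit-injective {Q} {R} {Q'} {R'} R<n R'<n eq = Q≡Q' , R≡R'
    where
    instance
      n≢0 : NonZero n
      n≢0 = >-nonZero (≤-<-trans z≤n R<n)
    sums : R + Q * n ≡ R' + Q' * n
    sums = trans (+-comm R _) (trans (suc-injective eq) (+-comm _ R'))
    R≡R' : R ≡ R'
    R≡R' = begin
      R                 ≡⟨ m<n⇒m%n≡m R<n ⟨
      R % n             ≡⟨ [m+kn]%n≡m%n R Q n ⟨
      (R + Q * n) % n   ≡⟨ cong (_% n) sums ⟩
      (R' + Q' * n) % n ≡⟨ [m+kn]%n≡m%n R' Q' n ⟩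
      R' % n            ≡⟨ m<n⇒m%n≡m R'<n ⟩
      R'                ∎
    Q≡Q' : Q ≡ Q'
    Q≡Q' = *-cancelʳ-≡ Q Q' n (+-cancelˡ-≡ R _ _ (trans sums (cong (_+ Q' * n) (sym R≡R'))))

  digit-surjective : .{{_ : NonZero n}} → ∀ {w} → w < n * n →
                     ∃[ Q ] ∃[ R ] Q < n × R < n × digit Q R ≡ suc w
  digit-surjective {w} w<n*n = w / n , w % n , m<n*o⇒m/o<n w<n*n , m%n<n w n ,
    cong suc (trans (+-comm (w / n * n) (w % n)) (sym (m≡m%n+[m/n]*n w n)))

-- n is written suc n₁ so that NonZero n and suc (pred n) ≡ n hold by computation.
module Square (k₀ n₁ : ℕ) (n≡k*4 : suc n₁ ≡ suc k₀ * 4) where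

  k : ℕ
  k = suc k₀

  n : ℕ
  n = suc n₁

  open Construction n
  open Digits n

  m≡k*2 : m ≡ k * 2
  m≡k*2 = trans (cong (_/ 2) (trans n≡k*4 (quadruple k))) (m*n/n≡m (k * 2) 2)
    where
    quadruple : ∀ k → k * 4 ≡ k * 2 * 2
    quadruple = solve-∀

  n≡m+m : n ≡ m + m
  n≡m+m = trans n≡k*4 (trans (double k) (cong₂ _+_ (sym m≡k*2) (sym m≡k*2)))
    where
    double : ∀ k → k * 4 ≡ k * 2 + k * 2
    double = solve-∀

  2≤m : 2 ≤ m
  2≤m = subst (2 ≤_) (sym m≡k*2) (s≤s (s≤s z≤n))

  suc-m<n : suc m < n
  suc-m<n = subst (suc (suc m) ≤_) (sym n≡m+m) (subst (_≤ m + m) (+-comm m 2) (+-monoʳ-≤ m 2≤m))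

  m<n : m < n
  m<n = <-trans (n<1+n m) suc-m<n

  mirror+suc≡m+m : ∀ {y} → y < n → mirror y + suc y ≡ m + m
  mirror+suc≡m+m y<n = trans (mirror-+ y<n) n≡m+m

  mirror<m : ∀ {y} → y < n → m ≤ y → mirror y < m
  mirror<m {y} y<n m≤y = +-cancelʳ-≤ y (suc (mirror y)) m
    (subst (_≤ m + y) (trans (sym (mirror+suc≡m+m y<n)) (+-suc (mirror y) y)) (+-monoʳ-≤ m m≤y))

  m≤mirror : ∀ {y} → y < m → m ≤ mirror y
  m≤mirror {y} y<m = +-cancelʳ-≤ (suc y) m (mirror y)
    (subst (m + suc y ≤_) (sym (mirror+suc≡m+m (<-trans y<m m<n))) (+-monoʳ-≤ m y<m))

  m≤ᵇmirror : ∀ {y} → y < n → (m ≤ᵇ mirror y) ≡ not (m ≤ᵇ y)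
  m≤ᵇmirror {y} y<n with m ≤? y
  ... | yes m≤y = trans (≤ᵇ-false (mirror<m y<n m≤y)) (cong not (sym (≤ᵇ-true m≤y)))
  ... | no  m≰y = trans (≤ᵇ-true (m≤mirror (≰⇒> m≰y))) (cong not (sym (≤ᵇ-false (≰⇒> m≰y))))

  m≤ᵇmirrorIf-left : ∀ {c} → c < m → ∀ β → (m ≤ᵇ mirrorIf β c) ≡ β
  m≤ᵇmirrorIf-left c<m true  = ≤ᵇ-true (m≤mirror c<m)
  m≤ᵇmirrorIf-left c<m false = ≤ᵇ-false c<m

  m≤ᵇmirrorIf-right : ∀ {c} → m ≤ c → c < n → ∀ β → (m ≤ᵇ mirrorIf β c) ≡ not β
  m≤ᵇmirrorIf-right m≤c c<n true  = ≤ᵇ-false (mirror<m c<n m≤c)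
  m≤ᵇmirrorIf-right m≤c c<n false = ≤ᵇ-true m≤c

  switchedRow : ℕ → Bool
  switchedRow r = switched (suc r)

  high : ℕ → ℕ → ℕ
  high r c = mirrorIf (switchedRow r) c

  low : ℕ → ℕ → ℕ
  low r c = mirrorIf (m ≤ᵇ high r c) r

  high-< : ∀ {r c} → c < n → high r c < n
  high-< {r} = mirrorIf-< (switchedRow r)

  low-< : ∀ {r c} → r < n → low r c < n
  low-< {r} {c} = mirrorIf-< (m ≤ᵇ high r c)

  low-left : ∀ {r c} → c < m → low r c ≡ mirrorIf (switchedRow r) r
  low-left {r} c<m = cong (λ β → mirrorIf β r) (m≤ᵇmirrorIf-left c<m (switchedRow r))

  low-right : ∀ {r c} → m ≤ c → c < n → low r c ≡ mirrorIf (not (switchedRow r)) r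
  low-right {r} m≤c c<n = cong (λ β → mirrorIf β r) (m≤ᵇmirrorIf-right m≤c c<n (switchedRow r))

  high-mirror : ∀ r c → high r (mirror c) ≡ mirror (high r c)
  high-mirror r = mirrorIf-mirror (switchedRow r)

  low-mirror : ∀ {r c} → r < n → c < n → low r (mirror c) ≡ mirror (low r c)
  low-mirror {r} {c} r<n c<n = begin
    mirrorIf (m ≤ᵇ high r (mirror c)) r ≡⟨ cong (λ y → mirrorIf (m ≤ᵇ y) r) (high-mirror r c) ⟩
    mirrorIf (m ≤ᵇ mirror (high r c)) r ≡⟨ cong (λ β → mirrorIf β r) (m≤ᵇmirror (high-< c<n)) ⟩
    mirrorIf (not (m ≤ᵇ high r c)) r    ≡⟨ mirrorIf-not (m ≤ᵇ high r c) r<n ⟩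
    mirror (low r c)                    ∎

  B₀ : ℕ → ℕ → ℕ
  B₀ r c = b (suc r) (suc c)

  b-left : ∀ {i c} → c < m → b i (suc c) ≡ bLeft i (suc c)
  b-left {i} {c} c<m =
    cong (λ β → if β then bLeft i (suc c) else n * n + 1 ∸ bLeft i (n + 1 ∸ suc c)) (≤ᵇ-true c<m)

  b-right : ∀ {i c} → m ≤ c → b i (suc c) ≡ n * n + 1 ∸ bLeft i (n + 1 ∸ suc c)
  b-right {i} {c} m≤c =
    cong (λ β → if β then bLeft i (suc c) else n * n + 1 ∸ bLeft i (n + 1 ∸ suc c)) (≤ᵇ-false (s≤s m≤c))

  bLeft-digits : ∀ {r c} → r < n → c < m → bLeft (suc r) (suc c) ≡ digit (high r c) (low r c)
  bLeft-digits {r} {c} r<n c<m = begin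
    bLeft (suc r) (suc c)
      ≡⟨ cong (λ x → if switchedRow r then n * n + 1 ∸ x else x) (+-suc (c * n) r) ⟩
    (if switchedRow r then n * n + 1 ∸ digit c r else digit c r)
      ≡⟨ mirrorIf-complement (switchedRow r) (<-trans c<m m<n) r<n ⟩
    digit (high r c) (mirrorIf (switchedRow r) r)
      ≡⟨ cong (digit (high r c)) (low-left c<m) ⟨
    digit (high r c) (low r c)
      ∎

  B₀-digits : ∀ {r c} → r < n → c < n → B₀ r c ≡ digit (high r c) (low r c)
  B₀-digits {r} {c} r<n c<n with c <? m
  ... | yes c<m = trans (b-left c<m) (bLeft-digits r<n c<m)
  ... | no c≮m = begin
    B₀ r c
      ≡⟨ b-right (≮⇒≥ c≮m) ⟩
    n * n + 1 ∸ bLeft (suc r) (n + 1 ∸ suc c)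
      ≡⟨ cong (λ j → n * n + 1 ∸ bLeft (suc r) j) (suc-mirror c<n) ⟨
    n * n + 1 ∸ bLeft (suc r) (suc (mirror c))
      ≡⟨ cong (n * n + 1 ∸_) (bLeft-digits r<n (mirror<m c<n (≮⇒≥ c≮m))) ⟩
    n * n + 1 ∸ digit (high r (mirror c)) (low r (mirror c))
      ≡⟨ cong₂ (λ Q R → n * n + 1 ∸ digit Q R) (high-mirror r c) (low-mirror r<n c<n) ⟩
    n * n + 1 ∸ digit (mirror (high r c)) (mirror (low r c))
      ≡⟨ complement-digit (high-< c<n) (low-< r<n) ⟩
    digit (high r c) (low r c)
      ∎

  B₀-complement : ∀ {r c} → r < n → c < n → B₀ r c + B₀ r (mirror c) ≡ n * n + 1
  B₀-complement {r} {c} r<n c<n = begin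
    B₀ r c + B₀ r (mirror c)
      ≡⟨ cong₂ _+_ (B₀-digits r<n c<n) (B₀-digits r<n (mirror-< c<n)) ⟩
    digit (high r c) (low r c) + digit (high r (mirror c)) (low r (mirror c))
      ≡⟨ cong₂ (λ Q R → digit (high r c) (low r c) + digit Q R) (high-mirror r c) (low-mirror r<n c<n) ⟩
    digit (high r c) (low r c) + digit (mirror (high r c)) (mirror (low r c))
      ≡⟨ digit-mirror (high-< c<n) (low-< r<n) ⟩
    n * n + 1
      ∎

  B₀-range : ∀ {r c} → r < n → c < n → 1 ≤ B₀ r c × B₀ r c ≤ n * n
  B₀-range r<n c<n rewrite B₀-digits r<n c<n = s≤s z≤n , digit-≤ (high-< c<n) (low-< r<n)

  B₀-injective : ∀ {r c r' c'} → r < n → c < n → r' < n → c' < n → B₀ r c ≡ B₀ r' c' → r ≡ r' × c ≡ c'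
  B₀-injective {r} {c} {r'} {c'} r<n c<n r'<n c'<n eq = r≡r' , c≡c'
    where
    digits≡ : high r c ≡ high r' c' × low r c ≡ low r' c'
    digits≡ = digit-injective (low-< r<n) (low-< r'<n)
                (trans (sym (B₀-digits r<n c<n)) (trans eq (B₀-digits r'<n c'<n)))
    r≡r' : r ≡ r'
    r≡r' = begin
      r                                      ≡⟨ mirrorIf-involutive (m ≤ᵇ high r c) r<n ⟨
      mirrorIf (m ≤ᵇ high r c) (low r c)     ≡⟨ cong₂ (λ Q R → mirrorIf (m ≤ᵇ Q) R) (proj₁ digits≡) (proj₂ digits≡) ⟩
      mirrorIf (m ≤ᵇ high r' c') (low r' c') ≡⟨ mirrorIf-involutive (m ≤ᵇ high r' c') r'<n ⟩
      r'                                     ∎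
    c≡c' : c ≡ c'
    c≡c' = begin
      c                                    ≡⟨ mirrorIf-involutive (switchedRow r) c<n ⟨
      mirrorIf (switchedRow r) (high r c)  ≡⟨ cong₂ (λ ρ Q → mirrorIf (switchedRow ρ) Q) r≡r' (proj₁ digits≡) ⟩
      mirrorIf (switchedRow r') (high r' c') ≡⟨ mirrorIf-involutive (switchedRow r') c'<n ⟩
      c'                                   ∎

  B₀-surjective : ∀ {w} → w < n * n → ∃[ r ] ∃[ c ] r < n × c < n × B₀ r c ≡ suc w
  B₀-surjective {w} w<n*n with digit-surjective w<n*n
  ... | Q , R , Q<n , R<n , digitQR = r , c , r<n , c<n , (begin
    B₀ r c                     ≡⟨ B₀-digits r<n c<n ⟩
    digit (high r c) (low r c) ≡⟨ cong₂ digit high≡Q low≡R ⟩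
    digit Q R                  ≡⟨ digitQR ⟩
    suc w                      ∎)
    where
    r c : ℕ
    r = mirrorIf (m ≤ᵇ Q) R
    c = mirrorIf (switchedRow r) Q
    r<n : r < n
    r<n = mirrorIf-< (m ≤ᵇ Q) R<n
    c<n : c < n
    c<n = mirrorIf-< (switchedRow r) Q<n
    high≡Q : high r c ≡ Q
    high≡Q = mirrorIf-involutive (switchedRow r) Q<n
    low≡R : low r c ≡ R
    low≡R = trans (cong (λ y → mirrorIf (m ≤ᵇ y) r) high≡Q) (mirrorIf-involutive (m ≤ᵇ Q) R<n)

  B₀-left : ∀ {r c s} → r < n → c < m → switchedRow r ≡ s → B₀ r c ≡ digit (mirrorIf s c) (mirrorIf s r)
  B₀-left {r} {c} r<n c<m refl = trans (B₀-digits r<n (<-trans c<m m<n)) (cong (digit (high r c)) (low-left c<m))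

  B₀-right : ∀ {r c s} → r < n → c < n → m ≤ c → switchedRow r ≡ s →
             B₀ r c ≡ digit (mirrorIf s c) (mirrorIf (not s) r)
  B₀-right {r} {c} r<n c<n m≤c refl = trans (B₀-digits r<n c<n) (cong (digit (high r c)) (low-right m≤c c<n))

  isEven-odd : ∀ t → isEven (suc (t * 2)) ≡ false
  isEven-odd t = cong (_≡ᵇ 0) ([m+kn]%n≡m%n 1 t 2)

  isEven-even : ∀ t → isEven (suc (suc (t * 2))) ≡ true
  isEven-even t = cong (_≡ᵇ 0) ([m+kn]%n≡m%n 2 t 2)

  switched-by : ∀ {i β₁ β₂} → (i ≤ᵇ m) ≡ β₁ → isEven i ≡ β₂ →
                switched i ≡ (β₁ ∧ β₂) ∨ (not β₁ ∧ not β₂)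
  switched-by = cong₂ (λ β₁ β₂ → (β₁ ∧ β₂) ∨ (not β₁ ∧ not β₂))

  2t+2≤m : ∀ {t} → t < k → suc (suc (t * 2)) ≤ m
  2t+2≤m {t} t<k = subst (suc (suc (t * 2)) ≤_) (sym m≡k*2) (*-monoˡ-≤ 2 t<k)

  m+2t≡[k+t]*2 : ∀ t → m + t * 2 ≡ (k + t) * 2
  m+2t≡[k+t]*2 t = trans (cong (_+ t * 2) m≡k*2) (sym (*-distribʳ-+ 2 k t))

  m+2t+1<n : ∀ {t} → t < k → suc (m + t * 2) < n
  m+2t+1<n {t} t<k = subst (suc (suc (m + t * 2)) ≤_) (sym n≡m+m)
    (subst (_≤ m + m) (trans (+-suc m (suc (t * 2))) (cong suc (+-suc m (t * 2)))) (+-monoʳ-≤ m (2t+2≤m t<k)))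

  -- Row indices are 0-based, so the parity of r is opposite to that of the paper's row r + 1.
  switched-2t : ∀ {t} → t < k → switchedRow (t * 2) ≡ false
  switched-2t {t} t<k = switched-by (≤ᵇ-true (≤-trans (n≤1+n _) (2t+2≤m t<k))) (isEven-odd t)

  switched-2t+1 : ∀ {t} → t < k → switchedRow (suc (t * 2)) ≡ true
  switched-2t+1 {t} t<k = switched-by (≤ᵇ-true (2t+2≤m t<k)) (isEven-even t)

  switched-m+2t : ∀ t → switchedRow (m + t * 2) ≡ true
  switched-m+2t t = switched-by (≤ᵇ-false (s≤s (m≤m+n m (t * 2))))
    (trans (cong (isEven ∘ suc) (m+2t≡[k+t]*2 t)) (isEven-odd (k + t)))

  switched-m+2t+1 : ∀ t → switchedRow (suc (m + t * 2)) ≡ false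
  switched-m+2t+1 t = switched-by (≤ᵇ-false (s≤s (≤-trans (m≤m+n m (t * 2)) (n≤1+n _))))
    (trans (cong (isEven ∘ suc ∘ suc) (m+2t≡[k+t]*2 t)) (isEven-even (k + t)))

  ∑-rows : ∀ g → ∑ n g ≡ ∑ k (λ t → g (t * 2) + g (suc (t * 2)))
                      + ∑ k (λ t → g (m + t * 2) + g (suc (m + t * 2)))
  ∑-rows g = begin
    ∑ n g                                     ≡⟨ cong (λ x → ∑ x g) n≡m+m ⟩
    ∑ (m + m) g                               ≡⟨ ∑-split m m g ⟩
    ∑ m g + ∑ m (λ r → g (m + r))             ≡⟨ cong₂ (λ x y → ∑ x g + ∑ y (λ r → g (m + r))) m≡k*2 m≡k*2 ⟩
    ∑ (k * 2) g + ∑ (k * 2) (λ r → g (m + r)) ≡⟨ cong₂ _+_ (∑-pairs k g) (∑-pairs k (λ r → g (m + r))) ⟩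
    top + ∑ k (λ t → g (m + t * 2) + g (m + suc (t * 2)))
      ≡⟨ cong (top +_) (∑-cong k (λ t _ → cong (λ x → g (m + t * 2) + g x) (+-suc m (t * 2)))) ⟩
    top + ∑ k (λ t → g (m + t * 2) + g (suc (m + t * 2))) ∎
    where
    top : ℕ
    top = ∑ k (λ t → g (t * 2) + g (suc (t * 2)))

  2t+1<n : ∀ {t} → t < k → suc (t * 2) < n
  2t+1<n t<k = <-trans (2t+2≤m t<k) m<n

  m+2t<n : ∀ {t} → t < k → m + t * 2 < n
  m+2t<n t<k = <-trans (n<1+n _) (m+2t+1<n t<k)

  column-pair-top : ∀ {t c} → t < k → c < m → B₀ (t * 2) c + B₀ (suc (t * 2)) c ≡ n * n
  column-pair-top t<k c<m =
    trans (cong₂ _+_ (B₀-left (<-trans (n<1+n _) (2t+1<n t<k)) c<m (switched-2t t<k))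
                     (B₀-left (2t+1<n t<k) c<m (switched-2t+1 t<k)))
          (digit-mirror-suc (<-trans c<m m<n) (2t+1<n t<k))

  column-pair-bottom : ∀ {t c} → t < k → c < m → B₀ (m + t * 2) c + B₀ (suc (m + t * 2)) c ≡ n * n + 2
  column-pair-bottom {t} {c} t<k c<m = begin
    B₀ r c + B₀ (suc r) c
      ≡⟨ cong₂ _+_ (B₀-left (m+2t<n t<k) c<m (switched-m+2t t)) (B₀-left (m+2t+1<n t<k) c<m (switched-m+2t+1 t)) ⟩
    digit (mirror c) (mirror r) + digit c (suc r) ≡⟨ cong (digit (mirror c) (mirror r) +_) (digit-sucʳ c r) ⟩
    digit (mirror c) (mirror r) + suc (digit c r) ≡⟨ +-suc (digit (mirror c) (mirror r)) (digit c r) ⟩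
    suc (digit (mirror c) (mirror r) + digit c r) ≡⟨ cong suc (+-comm (digit (mirror c) (mirror r)) (digit c r)) ⟩
    suc (digit c r + digit (mirror c) (mirror r)) ≡⟨ cong suc (digit-mirror (<-trans c<m m<n) (m+2t<n t<k)) ⟩
    suc (n * n + 1)                               ≡⟨ +-suc (n * n) 1 ⟨
    n * n + 2                                     ∎
    where
    r : ℕ
    r = m + t * 2

  diagonal-pair-top : ∀ {t} → t < k → B₀ (t * 2) (t * 2) + B₀ (suc (t * 2)) (suc (t * 2)) + n ≡ n * n
  diagonal-pair-top {t} t<k = begin
    B₀ r r + B₀ (suc r) (suc r) + n
      ≡⟨ cong (_+ n) (cong₂ _+_ (B₀-left (<-trans (n<1+n r) r+1<n) (≤-trans (n≤1+n _) (2t+2≤m t<k)) (switched-2t t<k))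
                                (B₀-left r+1<n (2t+2≤m t<k) (switched-2t+1 t<k))) ⟩
    digit r r + digit (mirror (suc r)) (mirror (suc r)) + n ≡⟨ xy∙z≈xz∙y (digit r r) _ n ⟩
    digit r r + n + digit (mirror (suc r)) (mirror (suc r))
      ≡⟨ cong (_+ digit (mirror (suc r)) (mirror (suc r))) (digit-sucˡ r r) ⟨
    digit (suc r) r + digit (mirror (suc r)) (mirror (suc r)) ≡⟨ digit-mirror-suc r+1<n r+1<n ⟩
    n * n ∎
    where
    r : ℕ
    r = t * 2
    r+1<n : suc r < n
    r+1<n = 2t+1<n t<k

  diagonal-pair-bottom : ∀ {t} → t < k →
                         B₀ (m + t * 2) (m + t * 2) + B₀ (suc (m + t * 2)) (suc (m + t * 2)) ≡ n * n + n
  diagonal-pair-bottom {t} t<k = begin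
    B₀ r r + B₀ (suc r) (suc r)
      ≡⟨ cong₂ _+_ (B₀-right r<n r<n (m≤m+n m _) (switched-m+2t t))
                   (B₀-right r+1<n r+1<n (≤-trans (m≤m+n m _) (n≤1+n _)) (switched-m+2t+1 t)) ⟩
    digit (mirror r) r + digit (suc r) (mirror (suc r))      ≡⟨ cong (digit (mirror r) r +_) (digit-sucˡ r (mirror (suc r))) ⟩
    digit (mirror r) r + (digit r (mirror (suc r)) + n)      ≡⟨ +-assoc (digit (mirror r) r) (digit r (mirror (suc r))) n ⟨
    digit (mirror r) r + digit r (mirror (suc r)) + n
      ≡⟨ cong (λ Q → digit (mirror r) r + digit Q (mirror (suc r)) + n) (mirror-involutive r<n) ⟨
    digit (mirror r) r + digit (mirror (mirror r)) (mirror (suc r)) + n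
      ≡⟨ cong (_+ n) (digit-mirror-suc (mirror-< r<n) r+1<n) ⟩
    n * n + n ∎
    where
    r : ℕ
    r = m + t * 2
    r<n : r < n
    r<n = m+2t<n t<k
    r+1<n : suc r < n
    r+1<n = m+2t+1<n t<k

  magicSum : ℕ
  magicSum = k * 2 * (n * n + 1)

  ∑-column-B₀ : ∀ {c} → c < m → ∑ n (λ r → B₀ r c) ≡ magicSum
  ∑-column-B₀ {c} c<m = begin
    ∑ n (λ r → B₀ r c)
      ≡⟨ ∑-rows (λ r → B₀ r c) ⟩
    ∑ k (λ t → B₀ (t * 2) c + B₀ (suc (t * 2)) c) + ∑ k (λ t → B₀ (m + t * 2) c + B₀ (suc (m + t * 2)) c)
      ≡⟨ cong₂ _+_ (∑-cong k (λ t t<k → column-pair-top t<k c<m)) (∑-cong k (λ t t<k → column-pair-bottom t<k c<m)) ⟩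
    ∑ k (λ _ → n * n) + ∑ k (λ _ → n * n + 2)
      ≡⟨ cong₂ _+_ (∑-const k (n * n)) (∑-const k (n * n + 2)) ⟩
    k * (n * n) + k * (n * n + 2)
      ≡⟨ regroup k (n * n) ⟩
    magicSum
      ∎
    where
    regroup : ∀ k x → k * x + k * (x + 2) ≡ k * 2 * (x + 1)
    regroup = solve-∀

  ∑-diagonal-B₀ : ∑ n (λ r → B₀ r r) ≡ k * 2 * (n * n)
  ∑-diagonal-B₀ = +-cancelʳ-≡ (k * n) _ _ (begin
    ∑ n d + k * n                                      ≡⟨ cong (_+ k * n) (∑-rows d) ⟩
    top + bottom + k * n                               ≡⟨ xy∙z≈xz∙y top bottom (k * n) ⟩
    top + k * n + bottom                               ≡⟨ cong (λ x → top + x + bottom) (∑-const k n) ⟨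
    top + ∑ k (λ _ → n) + bottom
      ≡⟨ cong (_+ bottom) (∑-distrib-+ k (λ t → d (t * 2) + d (suc (t * 2))) (λ _ → n)) ⟨
    ∑ k (λ t → d (t * 2) + d (suc (t * 2)) + n) + bottom
      ≡⟨ cong₂ _+_ (∑-cong k (λ t → diagonal-pair-top)) (∑-cong k (λ t → diagonal-pair-bottom)) ⟩
    ∑ k (λ _ → n * n) + ∑ k (λ _ → n * n + n)          ≡⟨ cong₂ _+_ (∑-const k (n * n)) (∑-const k (n * n + n)) ⟩
    k * (n * n) + k * (n * n + n)                      ≡⟨ regroup k (n * n) n ⟩
    k * 2 * (n * n) + k * n                            ∎)
    where
    d : ℕ → ℕ
    d r = B₀ r r
    top bottom : ℕ
    top = ∑ k (λ t → d (t * 2) + d (suc (t * 2)))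
    bottom = ∑ k (λ t → d (m + t * 2) + d (suc (m + t * 2)))
    regroup : ∀ k x n → k * x + k * (x + n) ≡ k * 2 * x + k * n
    regroup = solve-∀

  middle : ℕ → Bool
  middle c = (suc c ≡ᵇ m) ∨ (suc c ≡ᵇ m + 1)

  rowSwap : ℕ → ℕ → ℕ
  rowSwap c = swapIf (middle c) m (pred n)

  A₀ : ℕ → ℕ → ℕ
  A₀ r c = a (suc r) (suc c)

  A₀≡B₀∘rowSwap : ∀ r c → A₀ r c ≡ B₀ (rowSwap c r) c
  A₀≡B₀∘rowSwap r c = sym (begin
    B₀ (rowSwap c r) c
      ≡⟨ if-float (λ x → b (suc x) j) (middle c) ⟩
    (if middle c then b (suc (swap m (pred n) r)) j else b (suc r) j)
      ≡⟨ cong (λ x → if middle c then x else b (suc r) j) swapped ⟩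
    A₀ r c
      ∎)
    where
    j : ℕ
    j = suc c
    swapped : b (suc (swap m (pred n) r)) j
            ≡ (if suc r ≡ᵇ m + 1 then b n j else if suc r ≡ᵇ n then b (m + 1) j else b (suc r) j)
    swapped = begin
      b (suc (swap m (pred n) r)) j
        ≡⟨ if-float (λ x → b (suc x) j) (r ≡ᵇ m) ⟩
      (if r ≡ᵇ m then b n j else b (suc (if r ≡ᵇ pred n then m else r)) j)
        ≡⟨ cong (λ x → if r ≡ᵇ m then b n j else x) (if-float (λ x → b (suc x) j) (r ≡ᵇ pred n)) ⟩
      (if r ≡ᵇ m then b n j else if r ≡ᵇ pred n then b (suc m) j else b (suc r) j)
        ≡⟨ cong (λ x → if suc r ≡ᵇ x then b n j else if r ≡ᵇ pred n then b x j else b (suc r) j) (+-comm m 1) ⟨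
      (if suc r ≡ᵇ m + 1 then b n j else if suc r ≡ᵇ n then b (m + 1) j else b (suc r) j)
        ∎

  m≢pred-n : m ≢ pred n
  m≢pred-n m≡pred-n = <⇒≢ suc-m<n (cong suc m≡pred-n)

  rowSwap-< : ∀ c {r} → r < n → rowSwap c r < n
  rowSwap-< c = swapIf-< m≢pred-n (middle c) m<n (n<1+n (pred n))

  rowSwap-involutive : ∀ c r → rowSwap c (rowSwap c r) ≡ r
  rowSwap-involutive c = swapIf-involutive m≢pred-n (middle c)

  ∑-rowSwap : ∀ c g → ∑ n (λ r → g (rowSwap c r)) ≡ ∑ n g
  ∑-rowSwap c g = ∑-swapIf m≢pred-n n g (middle c) m<n (n<1+n (pred n))

  mirror≡m⇔suc≡m : ∀ {y} → y < n → (mirror y ≡ m ⇔ suc y ≡ m)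
  mirror≡m⇔suc≡m {y} y<n = mk⇔
    (λ my≡m → +-cancelˡ-≡ m (suc y) m (trans (cong (_+ suc y) (sym my≡m)) (mirror+suc≡m+m y<n)))
    (λ sy≡m → +-cancelʳ-≡ m (mirror y) m (trans (cong (mirror y +_) (sym sy≡m)) (mirror+suc≡m+m y<n)))

  middle-mirror : ∀ {c} → c < n → middle (mirror c) ≡ middle c
  middle-mirror {c} c<n = begin
    (suc (mirror c) ≡ᵇ m) ∨ (suc (mirror c) ≡ᵇ m + 1) ≡⟨ cong₂ _∨_ first second ⟩
    (c ≡ᵇ m) ∨ (suc c ≡ᵇ m)                           ≡⟨ ∨-comm (c ≡ᵇ m) (suc c ≡ᵇ m) ⟩
    (suc c ≡ᵇ m) ∨ (c ≡ᵇ m)                           ≡⟨ cong (λ x → (suc c ≡ᵇ m) ∨ (suc c ≡ᵇ x)) (+-comm m 1) ⟨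
    middle c                                          ∎
    where
    first : (suc (mirror c) ≡ᵇ m) ≡ (c ≡ᵇ m)
    first = sym (≡ᵇ-cong-⇔ (subst (λ x → x ≡ m ⇔ suc (mirror c) ≡ m) (mirror-involutive c<n)
                                  (mirror≡m⇔suc≡m (mirror-< c<n))))
    second : (suc (mirror c) ≡ᵇ m + 1) ≡ (suc c ≡ᵇ m)
    second = trans (cong (suc (mirror c) ≡ᵇ_) (+-comm m 1)) (≡ᵇ-cong-⇔ (mirror≡m⇔suc≡m c<n))

  rowSwap-mirror : ∀ {c} r → c < n → rowSwap (mirror c) r ≡ rowSwap c r
  rowSwap-mirror r c<n = cong (λ β → swapIf β m (pred n) r) (middle-mirror c<n)

  A₀-complement : ∀ {r c} → r < n → c < n → A₀ r c + A₀ r (mirror c) ≡ n * n + 1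
  A₀-complement {r} {c} r<n c<n = begin
    A₀ r c + A₀ r (mirror c)
      ≡⟨ cong₂ _+_ (A₀≡B₀∘rowSwap r c)
                   (trans (A₀≡B₀∘rowSwap r (mirror c)) (cong (λ ρ → B₀ ρ (mirror c)) (rowSwap-mirror r c<n))) ⟩
    B₀ (rowSwap c r) c + B₀ (rowSwap c r) (mirror c)
      ≡⟨ B₀-complement (rowSwap-< c r<n) c<n ⟩
    n * n + 1
      ∎

  A₀-range : ∀ {r c} → r < n → c < n → 1 ≤ A₀ r c × A₀ r c ≤ n * n
  A₀-range {r} {c} r<n c<n rewrite A₀≡B₀∘rowSwap r c = B₀-range (rowSwap-< c r<n) c<n

  A₀-injective : ∀ {r c r' c'} → r < n → c < n → r' < n → c' < n → A₀ r c ≡ A₀ r' c' → r ≡ r' × c ≡ c'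
  A₀-injective {r} {c} {r'} {c'} r<n c<n r'<n c'<n eq = r≡r' , proj₂ swapped≡
    where
    swapped≡ : rowSwap c r ≡ rowSwap c' r' × c ≡ c'
    swapped≡ = B₀-injective (rowSwap-< c r<n) c<n (rowSwap-< c' r'<n) c'<n
                 (trans (sym (A₀≡B₀∘rowSwap r c)) (trans eq (A₀≡B₀∘rowSwap r' c')))
    r≡r' : r ≡ r'
    r≡r' = begin
      r                         ≡⟨ rowSwap-involutive c r ⟨
      rowSwap c (rowSwap c r)   ≡⟨ cong (rowSwap c) (proj₁ swapped≡) ⟩
      rowSwap c (rowSwap c' r') ≡⟨ cong (λ x → rowSwap x (rowSwap c' r')) (proj₂ swapped≡) ⟩
      rowSwap c' (rowSwap c' r') ≡⟨ rowSwap-involutive c' r' ⟩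
      r'                        ∎

  A₀-surjective : ∀ {w} → w < n * n → ∃[ r ] ∃[ c ] r < n × c < n × A₀ r c ≡ suc w
  A₀-surjective w<n*n with B₀-surjective w<n*n
  ... | r , c , r<n , c<n , B₀rc = rowSwap c r , c , rowSwap-< c r<n , c<n ,
    trans (A₀≡B₀∘rowSwap (rowSwap c r) c) (trans (cong (λ ρ → B₀ ρ c) (rowSwap-involutive c r)) B₀rc)

  middle-m : middle m ≡ true
  middle-m = cong₂ _∨_ (≡ᵇ-false (<⇒≢ (n<1+n m) ∘ sym)) (≡ᵇ-true (+-comm 1 m))

  middle-pred-n : middle (pred n) ≡ false
  middle-pred-n = cong₂ _∨_ (≡ᵇ-false (<⇒≢ m<n ∘ sym))
                            (≡ᵇ-false (λ n≡m+1 → <⇒≢ suc-m<n (sym (trans n≡m+1 (+-comm m 1)))))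

  rowSwap-diagonal : ∀ {r} → r ≢ m → rowSwap r r ≡ r
  rowSwap-diagonal {r} r≢m with r ≟ pred n
  ... | yes refl  = cong (λ β → swapIf β m (pred n) (pred n)) middle-pred-n
  ... | no  r≢n-1 = swapIf-fixes r≢m r≢n-1 (middle r)

  switched-m : switchedRow m ≡ true
  switched-m = subst (λ r → switchedRow r ≡ true) (+-identityʳ m) (switched-m+2t 0)

  switched-pred-n : switchedRow (pred n) ≡ false
  switched-pred-n = subst (λ r → switchedRow r ≡ false) last-row (switched-m+2t+1 k₀)
    where
    count : ∀ j → suc (suc (suc j * 2 + j * 2)) ≡ suc j * 4
    count = solve-∀
    last-row : suc (m + k₀ * 2) ≡ pred n
    last-row = suc-injective
      (trans (cong (λ x → suc (suc (x + k₀ * 2))) m≡k*2) (trans (count k₀) (sym n≡k*4)))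

  suc-mirror-m : suc (mirror m) ≡ m
  suc-mirror-m = +-cancelʳ-≡ m (suc (mirror m)) m (trans (sym (+-suc (mirror m) m)) (mirror+suc≡m+m m<n))

  A₀-diagonal-m : A₀ m m ≡ B₀ m m + m
  A₀-diagonal-m = begin
    A₀ m m                       ≡⟨ A₀≡B₀∘rowSwap m m ⟩
    B₀ (rowSwap m m) m           ≡⟨ cong (λ β → B₀ (swapIf β m (pred n) m) m) middle-m ⟩
    B₀ (swap m (pred n) m) m     ≡⟨ cong (λ r → B₀ r m) (swap-at-p {m} {pred n}) ⟩
    B₀ (pred n) m                ≡⟨ B₀-right (n<1+n (pred n)) m<n ≤-refl switched-pred-n ⟩
    digit m (mirror (pred n))    ≡⟨ cong (digit m) (n∸n≡0 n) ⟩
    suc (m * n + 0)              ≡⟨ cong suc (+-identityʳ (m * n)) ⟩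
    suc (m * n)                  ≡⟨ cong (λ x → suc (x * n)) suc-mirror-m ⟨
    suc (suc (mirror m) * n)     ≡⟨ cong suc (+-comm n (mirror m * n)) ⟩
    suc (mirror m * n + n)       ≡⟨ cong (λ x → suc (mirror m * n + x)) n≡m+m ⟩
    suc (mirror m * n + (m + m)) ≡⟨ cong suc (+-assoc (mirror m * n) m m) ⟨
    digit (mirror m) m + m       ≡⟨ cong (_+ m) (B₀-right m<n m<n ≤-refl switched-m) ⟨
    B₀ m m + m                   ∎

  ∑-diagonal-A₀ : ∑ n (λ r → A₀ r r) ≡ magicSum
  ∑-diagonal-A₀ = +-cancelʳ-≡ (B₀ m m) _ _ (begin
    ∑ n (λ r → A₀ r r) + B₀ m m        ≡⟨ ∑-differ-at n m<n off-m ⟩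
    ∑ n (λ r → B₀ r r) + A₀ m m        ≡⟨ cong₂ _+_ ∑-diagonal-B₀ A₀-diagonal-m ⟩
    k * 2 * (n * n) + (B₀ m m + m)     ≡⟨ cong (λ x → k * 2 * (n * n) + (B₀ m m + x)) m≡k*2 ⟩
    k * 2 * (n * n) + (B₀ m m + k * 2) ≡⟨ regroup (k * 2) (n * n) (B₀ m m) ⟩
    magicSum + B₀ m m                  ∎)
    where
    off-m : ∀ r → r < n → r ≢ m → A₀ r r ≡ B₀ r r
    off-m r _ r≢m = trans (A₀≡B₀∘rowSwap r r) (cong (λ ρ → B₀ ρ r) (rowSwap-diagonal r≢m))
    regroup : ∀ a x y → a * x + (y + a) ≡ a * (x + 1) + y
    regroup = solve-∀

  double : ∀ x → x * 2 ≡ x + x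
  double = solve-∀

  total : n * (n * n + 1) ≡ magicSum * 2
  total = trans (cong (_* (n * n + 1)) n≡k*4) (regroup k (n * n + 1))
    where
    regroup : ∀ k x → k * 4 * x ≡ k * 2 * x * 2
    regroup = solve-∀

  magicConst≡magicSum : magicConst n ≡ magicSum
  magicConst≡magicSum = trans (cong (_/ 2) total) (m*n/n≡m magicSum 2)

  ∑-complement : ∀ f g → (∀ r → r < n → f r + g r ≡ n * n + 1) → ∑ n f + ∑ n g ≡ magicSum + magicSum
  ∑-complement f g f+g = begin
    ∑ n f + ∑ n g                ≡⟨ ∑-distrib-+ n f g ⟨
    ∑ n (λ r → f r + g r)        ≡⟨ ∑-cong n f+g ⟩
    ∑ n (λ _ → n * n + 1)        ≡⟨ ∑-const n (n * n + 1) ⟩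
    n * (n * n + 1)              ≡⟨ total ⟩
    magicSum * 2                 ≡⟨ double magicSum ⟩
    magicSum + magicSum          ∎

  ∑-complementary : ∀ f g → (∀ r → r < n → f r + g r ≡ n * n + 1) → ∑ n g ≡ magicSum → ∑ n f ≡ magicSum
  ∑-complementary f g f+g ∑g = +-cancelʳ-≡ magicSum _ _
    (trans (cong (∑ n f +_) (sym ∑g)) (∑-complement f g f+g))

  ∑-self-complementary : ∀ f → (∀ r → r < n → f r + f (mirror r) ≡ n * n + 1) → ∑ n f ≡ magicSum
  ∑-self-complementary f f+f∘mirror = *-cancelʳ-≡ (∑ n f) magicSum 2 (begin
    ∑ n f * 2                    ≡⟨ double (∑ n f) ⟩
    ∑ n f + ∑ n f                ≡⟨ cong (∑ n f +_) (∑-reverse n f) ⟩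
    ∑ n f + ∑ n (f ∘ mirror)     ≡⟨ ∑-complement f (f ∘ mirror) f+f∘mirror ⟩
    magicSum + magicSum          ≡⟨ double magicSum ⟨
    magicSum * 2                 ∎)

  ∑-row-A₀ : ∀ {r} → r < n → ∑ n (A₀ r) ≡ magicSum
  ∑-row-A₀ {r} r<n = ∑-self-complementary (A₀ r) (λ c → A₀-complement r<n)

  ∑-left-column-A₀ : ∀ {c} → c < m → ∑ n (λ r → A₀ r c) ≡ magicSum
  ∑-left-column-A₀ {c} c<m =
    trans (∑-cong n (λ r _ → A₀≡B₀∘rowSwap r c)) (trans (∑-rowSwap c (λ r → B₀ r c)) (∑-column-B₀ c<m))

  ∑-column-A₀ : ∀ {c} → c < n → ∑ n (λ r → A₀ r c) ≡ magicSum
  ∑-column-A₀ {c} c<n with c <? m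
  ... | yes c<m = ∑-left-column-A₀ c<m
  ... | no  c≮m = ∑-complementary (λ r → A₀ r c) (λ r → A₀ r (mirror c)) (λ r r<n → A₀-complement r<n c<n)
                    (∑-left-column-A₀ (mirror<m c<n (≮⇒≥ c≮m)))

  ∑-antidiagonal-A₀ : ∑ n (λ r → A₀ r (mirror r)) ≡ magicSum
  ∑-antidiagonal-A₀ = ∑-complementary (λ r → A₀ r (mirror r)) (λ r → A₀ r r)
    (λ r r<n → trans (+-comm (A₀ r (mirror r)) (A₀ r r)) (A₀-complement r<n r<n)) ∑-diagonal-A₀

  A-complement : ∀ (i j : Fin n) → A i j + A i (opposite j) ≡ n * n + 1
  A-complement i j =
    trans (cong (λ c → A i j + A₀ (toℕ i) c) (opposite-prop j)) (A₀-complement (toℕ<n i) (toℕ<n j))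

  A-injective : ∀ {i j i' j'} → A i j ≡ A i' j' → i ≡ i' × j ≡ j'
  A-injective {i} {j} {i'} {j'} eq =
    map toℕ-injective toℕ-injective (A₀-injective (toℕ<n i) (toℕ<n j) (toℕ<n i') (toℕ<n j') eq)

  A-surjective : ∀ {w} → w < n * n → ∃[ i ] ∃[ j ] A i j ≡ suc w
  A-surjective w<n*n =
    let r , c , r<n , c<n , A₀rc = A₀-surjective w<n*n
    in fromℕ< r<n , fromℕ< c<n , trans (cong₂ A₀ (toℕ-fromℕ< r<n) (toℕ-fromℕ< c<n)) A₀rc

  A-contains-each-once : ContainsEachOnce n A
  A-contains-each-once = (λ i j → A₀-range (toℕ<n i) (toℕ<n j)) , occurs-once
    where
    occurs-once : ∀ v → 1 ≤ v → v ≤ n * n →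
                  ∃[ i ] ∃[ j ] (A i j ≡ v × (∀ i' j' → A i' j' ≡ v → i' ≡ i × j' ≡ j))
    occurs-once (suc w) _ v≤n*n =
      let i , j , A≡v = A-surjective v≤n*n
      in i , j , A≡v , λ i' j' A'≡v → A-injective (trans A'≡v (sym A≡v))

  A-magic : IsMagicSquare n A
  A-magic = A-contains-each-once
          , (λ i → magic (sumFin≡∑ n (A₀ (toℕ i)) (λ _ → refl)) (∑-row-A₀ (toℕ<n i)))
          , (λ j → magic (sumFin≡∑ n (λ r → A₀ r (toℕ j)) (λ _ → refl)) (∑-column-A₀ (toℕ<n j)))
          , magic (sumFin≡∑ n (λ r → A₀ r r) (λ _ → refl)) ∑-diagonal-A₀
          , magic (sumFin≡∑ n (λ r → A₀ r (mirror r)) (cong (A₀ _) ∘ opposite-prop)) ∑-antidiagonal-A₀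
    where
    magic : ∀ {s t} → s ≡ t → t ≡ magicSum → s ≡ magicConst n
    magic s≡t t≡M = trans s≡t (trans t≡M (sym magicConst≡magicSum))

  complementary-same-row : ∀ {i j i' j'} → Complementary n A i j i' j' → i' ≡ i
  complementary-same-row {i} {j} {i'} {j'} compl =
    proj₁ (A-injective (+-cancelˡ-≡ (A i j) (A i' j') (A i (opposite j)) (trans compl (sym (A-complement i j)))))

  δ-self : ∀ {i i' : Fin n} → i' ≡ i → δ i i' ≡ ℤ.0ℤ
  δ-self {i} refl = ℤ.+-inverseʳ (ℤ.+ toℕ i)

  A-parallel : AllComplementaryPairsParallel n A
  A-parallel i j i' j' u v u' v' compl₁ compl₂ = begin
    δ i i' ℤ.* δ v v' ≡⟨ cong (ℤ._* δ v v') (δ-self (complementary-same-row {i} {j} {i'} {j'} compl₁)) ⟩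
    ℤ.0ℤ ℤ.* δ v v'   ≡⟨ ℤ.*-zeroˡ (δ v v') ⟩
    ℤ.0ℤ              ≡⟨ ℤ.*-zeroʳ (δ j j') ⟨
    δ j j' ℤ.* ℤ.0ℤ   ≡⟨ cong (δ j j' ℤ.*_) (δ-self (complementary-same-row {u} {v} {u'} {v'} compl₂)) ⟨
    δ j j' ℤ.* δ u u' ∎

  parallel-magic-square : IsParallelMagicSquare n A × (∀ (i j : Fin n) → A i j + A i (opposite j) ≡ n * n + 1)
  parallel-magic-square = (A-magic , A-parallel) , A-complement

mainTheorem1 : (n : ℕ) → 0 < n → 4 ∣ n →
    IsParallelMagicSquare n (Construction.A n) ×
    (∀ (i j : Fin n) → Construction.A n i j + Construction.A n i (opposite j) ≡ n * n + 1)
mainTheorem1 (suc n₁) _ (divides zero    ())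
mainTheorem1 (suc n₁) _ (divides (suc k₀) n≡k*4) = Square.parallel-magic-square k₀ n₁ n≡k*4
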